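{- Let $\mathbb{F}$ be any field. Let $u:[0,m-1]\to\{0,1\}$ be aperiodic, and let $u_j=u\circ\tau_m^j$ for $j\in[0,m-1]$. Then for any function $g:[0,m-1]\to\mathbb{F}$ there is a polynomial $P\in\mathbb{F}[Y_0,\dots,Y_{m-1}]$ of degree at most $\log m$ such that $g=P(u_0,\dots,u_{m-1})$ (pointwise on $[0,m-1]$).
   Context: $\tau_m:[0,m-1]\to[0,m-1]$ is the cyclic shift: $\tau_m(i)=i+1$ for $i<m-1$ and $\tau_m(m-1)=0$. A function $u:[0,m-1]\to\{0,1\}$ is periodic if $u\circ\tau_m^j=u$ for some $j\in[m-1]$, and aperiodic otherwise. Logarithms are base 2. -}

module Defs where

open import Level using (Level; _⊔_)
open import Data.Nat using (ℕ; zero; suc; _+_; _≤_; _<_)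
open import Data.Nat.DivMod using (_mod_)
import Data.Fin
open Data.Fin using (Fin; toℕ)
open import Data.Bool using (Bool; true; false)
open import Data.List using (List; []; _∷_)
open import Data.List.Relation.Unary.All using (All)
import Data.Product
open Data.Product using (Σ; _×_; ∃; _,_)
open import Relation.Nullary using (¬_)
open import Relation.Binary.PropositionalEquality using (_≡_)
open import Algebra.Bundles using (CommutativeRing)

record Field (c ℓ : Level) : Set (Level.suc (c ⊔ ℓ)) where
  field
    commutativeRing : CommutativeRing c ℓ
  open CommutativeRing commutativeRing public
  field
    0≉1     : ¬ (0# ≈ 1#)
    inverse : ∀ x → ¬ (x ≈ 0#) → Σ Carrier λ y → x * y ≈ 1#

τ : ∀ {m} → Fin m → Fin m
τ {suc n} i = suc (toℕ i) mod suc n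

τ^ : ∀ {m} → ℕ → Fin m → Fin m
τ^ zero    i = i
τ^ (suc j) i = τ (τ^ j i)

Periodic : ∀ {m} → (Fin m → Bool) → Set
Periodic {m} u = ∃ λ j → 1 ≤ j × j < m × (∀ i → u (τ^ j i) ≡ u i)

Aperiodic : ∀ {m} → (Fin m → Bool) → Set
Aperiodic u = ¬ Periodic u

shifted : ∀ {m} → (Fin m → Bool) → Fin m → Fin m → Bool
shifted u j = λ i → u (τ^ (toℕ j) i)

sumFin : ∀ {m} → (Fin m → ℕ) → ℕ
sumFin {zero}  f = 0
sumFin {suc m} f = f Data.Fin.zero + sumFin (λ i → f (Data.Fin.suc i))

module Poly {c ℓ} (F : Field c ℓ) where
  open Field F hiding (_+_; _*_)
  open Field F using () renaming (_+_ to _+F_; _*_ to _*F_)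

  Monomial : ℕ → Set
  Monomial m = Fin m → ℕ

  Polynomial : ℕ → Set c
  Polynomial m = List (Carrier × Monomial m)


  mdeg : ∀ {m} → Monomial m → ℕ
  mdeg = sumFin

  DegreeAtMost : ∀ {m} → ℕ → Polynomial m → Set c
  DegreeAtMost d P = All (λ t → mdeg (Data.Product.proj₂ t) ≤ d) P

  pow : Carrier → ℕ → Carrier
  pow x zero    = 1#
  pow x (suc k) = x *F pow x k

  prodFin : ∀ {m} → (Fin m → Carrier) → Carrier
  prodFin {zero}  f = 1#
  prodFin {suc m} f = f Data.Fin.zero *F prodFin (λ i → f (Data.Fin.suc i))

  evalMon : ∀ {m} → Monomial m → (Fin m → Carrier) → Carrier
  evalMon e y = prodFin (λ i → pow (y i) (e i))

  eval : ∀ {m} → Polynomial m → (Fin m → Carrier) → Carrier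
  eval [] y = 0#
  eval ((a , e) ∷ P) y = a *F evalMon e y +F eval P y

  ⌜_⌝ : Bool → Carrier
  ⌜ false ⌝ = 0#
  ⌜ true  ⌝ = 1#

module Submission where

-- The points x ∈ [0,m-1] are seen through their "profiles"
-- (u_0(x), …, u_{m-1}(x)) ∈ {0,1}^m.  The proof has two independent parts.
--
-- If u is aperiodic, distinct points have distinct
--     profiles: were u_j(x) = u_j(y) for all j with y = τ^d x, d ≠ 0, then
--     u ∘ τ^d = u, because every point is τ^t x for some t < m.
--
-- Let xs be a list of points with pairwise distinct
--     profiles and |xs| < 2^(d+1).  Then every g agrees on xs with a
--     polynomial of degree ≤ d.  Pick a coordinate i separating two points
--     and a bit b so that S = {x | y_i(x) = b} is the smaller side and L its
--     complement.  Interpolate g on L with degree ≤ d (L is shorter than xs),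
--     and g - Q on S with degree ≤ d - 1 (|S| < 2^d); then
--     Q + ℓ·R with ℓ = y_i or 1 - y_i (the indicator of S) interpolates g.
--
-- The theorem applies (2) to all m points with d = ⌊log₂ m⌋, using
-- m < 2^(⌊log₂ m⌋ + 1).

open import Defs
open import Level using (_⊔_)
open import Function using (_∘_)
open import Data.Nat as ℕ using (ℕ; zero; suc; _≤_; _<_; z≤n; s≤s; _∸_; _%_; _^_)
open import Data.Nat.Properties as ℕₚ
  using (≤-refl; ≤-reflexive; ≤-trans; <-≤-trans; <-trans; <-irrefl; n<1+n; ≮⇒≥; ≰⇒>; <⇒≤; _<?_; _≤?_;
         +-suc; m<n+m; m≤n⇒m≤1+n; m+[n∸m]≡n)
open import Data.Nat.DivMod using (_mod_; %-distribˡ-+; m%n%n≡m%n; [m+n]%n≡m%n; m<n⇒m%n≡m)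
open import Data.Nat.Logarithm using (⌊log₂_⌋; ⌊log₂⌋-mono-≤; ⌊log₂[2^n]⌋≡n)
open import Data.Fin using (Fin; toℕ; zero; suc)
open import Data.Fin.Properties using (toℕ-fromℕ<; toℕ<n; toℕ-injective; ¬∀⟶∃¬)
open import Data.Bool using (Bool; true; false; not)
open import Data.Bool.Properties using (¬-not) renaming (_≟_ to _≟ᵇ_)
open import Data.List using (List; []; _∷_; _++_; map; length; filter; allFin)
open import Data.List.Properties using (length-tabulate)
open import Data.List.Relation.Unary.All as All using ([]; _∷_)
import Data.List.Relation.Unary.All.Properties as All
open import Data.List.Relation.Unary.Any using (here; there)
open import Data.List.Relation.Unary.AllPairs as AllPairs using (AllPairs; []; _∷_)
import Data.List.Relation.Unary.AllPairs.Properties as AllPairs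
open import Data.List.Relation.Unary.Unique.Propositional.Properties using (allFin⁺)
open import Data.List.Membership.Propositional using (_∈_)
open import Data.List.Membership.Propositional.Properties
  using (∈-filter⁺; ∈-allFin)
open import Data.Product using (Σ; _×_; _,_)
open import Data.Empty using (⊥-elim)
open import Relation.Nullary using (yes; no)
open import Relation.Binary.PropositionalEquality
  using (_≡_; _≢_; refl; sym; trans; cong; subst; module ≡-Reasoning)
import Algebra.Properties.Ring as RingProperties
import Algebra.Properties.CommutativeSemigroup as CommutativeSemigroupProperties

τ^-+ : ∀ {m} a b (x : Fin m) → τ^ (a ℕ.+ b) x ≡ τ^ a (τ^ b x)
τ^-+ zero    b x = refl
τ^-+ (suc a) b x = cong τ (τ^-+ a b x)

τ^-comm : ∀ {m} a b (x : Fin m) → τ^ a (τ^ b x) ≡ τ^ b (τ^ a x)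
τ^-comm a b x = trans (sym (τ^-+ a b x)) (trans (cong (λ s → τ^ s x) (ℕₚ.+-comm a b)) (τ^-+ b a x))

[a+b%d]%d≡[a+b]%d : ∀ a b d .{{_ : ℕ.NonZero d}} → (a ℕ.+ b % d) % d ≡ (a ℕ.+ b) % d
[a+b%d]%d≡[a+b]%d a b d = begin
  (a ℕ.+ b % d) % d           ≡⟨ %-distribˡ-+ a (b % d) d ⟩
  (a % d ℕ.+ b % d % d) % d   ≡⟨ cong (λ t → (a % d ℕ.+ t) % d) (m%n%n≡m%n b d) ⟩
  (a % d ℕ.+ b % d) % d       ≡⟨ sym (%-distribˡ-+ a b d) ⟩
  (a ℕ.+ b) % d               ∎
  where open ≡-Reasoning

toℕ-τ^ : ∀ {k} j (x : Fin (suc k)) → toℕ (τ^ j x) ≡ (toℕ x ℕ.+ j) % suc k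
toℕ-τ^ {k} zero x = sym (trans (cong (_% suc k) (ℕₚ.+-identityʳ (toℕ x))) (m<n⇒m%n≡m (toℕ<n x)))
toℕ-τ^ {k} (suc j) x = begin
  toℕ (τ (τ^ j x))                    ≡⟨ toℕ-fromℕ< _ ⟩
  suc (toℕ (τ^ j x)) % suc k          ≡⟨ cong (λ t → suc t % suc k) (toℕ-τ^ j x) ⟩
  (1 ℕ.+ (toℕ x ℕ.+ j) % suc k) % suc k ≡⟨ [a+b%d]%d≡[a+b]%d 1 (toℕ x ℕ.+ j) (suc k) ⟩
  suc (toℕ x ℕ.+ j) % suc k           ≡⟨ cong (_% suc k) (sym (+-suc (toℕ x) j)) ⟩
  (toℕ x ℕ.+ suc j) % suc k           ∎
  where open ≡-Reasoning

reach : ∀ {m} (x y : Fin m) → Σ (Fin m) λ j → τ^ (toℕ j) x ≡ y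
reach {suc k} x y = j , toℕ-injective (begin
  toℕ (τ^ (toℕ j) x)                                ≡⟨ toℕ-τ^ (toℕ j) x ⟩
  (toℕ x ℕ.+ toℕ j) % m                              ≡⟨ cong (λ t → (toℕ x ℕ.+ t) % m) (toℕ-fromℕ< _) ⟩
  (toℕ x ℕ.+ d % m) % m                              ≡⟨ [a+b%d]%d≡[a+b]%d (toℕ x) d m ⟩
  (toℕ x ℕ.+ (m ∸ toℕ x ℕ.+ toℕ y)) % m              ≡⟨ cong (_% m) (sym (ℕₚ.+-assoc (toℕ x) (m ∸ toℕ x) (toℕ y))) ⟩
  (toℕ x ℕ.+ (m ∸ toℕ x) ℕ.+ toℕ y) % m              ≡⟨ cong (λ t → (t ℕ.+ toℕ y) % m) (m+[n∸m]≡n (<⇒≤ (toℕ<n x))) ⟩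
  (m ℕ.+ toℕ y) % m                                  ≡⟨ cong (_% m) (ℕₚ.+-comm m (toℕ y)) ⟩
  (toℕ y ℕ.+ m) % m                                  ≡⟨ [m+n]%n≡m%n (toℕ y) m ⟩
  toℕ y % m                                          ≡⟨ m<n⇒m%n≡m (toℕ<n y) ⟩
  toℕ y                                              ∎)
  where
  open ≡-Reasoning
  m d : ℕ
  m = suc k
  d = m ∸ toℕ x ℕ.+ toℕ y
  j : Fin m
  j = d mod m

-- For aperiodic u, a point is determined by its profile (u_j(x))_j: if
-- y = τ^(1+d) x had the same profile, u would have period 1+d.
profile-injective : ∀ {m} (u : Fin m → Bool) → Aperiodic u →
                    ∀ x y → (∀ j → shifted u j x ≡ shifted u j y) → x ≡ y
profile-injective u aperiodic x y same with reach x y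
... | zero  , x≡y = x≡y
... | suc d , τᵈx≡y = ⊥-elim (aperiodic (toℕ (suc d) , s≤s z≤n , toℕ<n (suc d) , period))
  where
  period : ∀ i → u (τ^ (toℕ (suc d)) i) ≡ u i
  period i with reach x i
  ... | t , τᵗx≡i = begin
    u (τ^ (toℕ (suc d)) i)              ≡⟨ cong (λ z → u (τ^ (toℕ (suc d)) z)) (sym τᵗx≡i) ⟩
    u (τ^ (toℕ (suc d)) (τ^ (toℕ t) x)) ≡⟨ cong u (τ^-comm (toℕ (suc d)) (toℕ t) x) ⟩
    u (τ^ (toℕ t) (τ^ (toℕ (suc d)) x)) ≡⟨ cong (λ z → u (τ^ (toℕ t) z)) τᵈx≡y ⟩
    u (τ^ (toℕ t) y)                    ≡⟨ sym (same t) ⟩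
    u (τ^ (toℕ t) x)                    ≡⟨ cong u τᵗx≡i ⟩
    u i                                 ∎
    where open ≡-Reasoning

-- m < 2^(⌊log₂ m⌋ + 1): otherwise ⌊log₂ m⌋ ≥ ⌊log₂ 2^(⌊log₂ m⌋+1)⌋ = ⌊log₂ m⌋ + 1.
<2^[1+⌊log₂⌋] : ∀ m → m < 2 ^ suc ⌊log₂ m ⌋
<2^[1+⌊log₂⌋] m with m <? 2 ^ suc ⌊log₂ m ⌋
... | yes m<2^ = m<2^
... | no m≮2^ = ⊥-elim (<-irrefl refl (<-≤-trans (n<1+n ⌊log₂ m ⌋)
      (subst (_≤ ⌊log₂ m ⌋) (⌊log₂[2^n]⌋≡n (suc ⌊log₂ m ⌋)) (⌊log₂⌋-mono-≤ (≮⇒≥ m≮2^)))))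

module PolynomialAlgebra {c ℓ} (F : Field c ℓ) where
  open Field F hiding (zero) renaming (_+_ to _⊕_; _*_ to _⊗_; refl to ≈-refl; sym to ≈-sym; trans to ≈-trans)
  open Poly F
  open RingProperties ring using (-0#≈0#; -‿distribˡ-*; -‿+-comm)
  open CommutativeSemigroupProperties *-commutativeSemigroup using (x∙yz≈y∙xz)
  open import Relation.Binary.Reasoning.Setoid setoid

  bump : ∀ {n} → Fin n → Monomial n → Monomial n
  bump zero    e zero    = suc (e zero)
  bump zero    e (suc j) = e (suc j)
  bump (suc i) e zero    = e zero
  bump (suc i) e (suc j) = bump i (λ k → e (suc k)) j

  mdeg-bump : ∀ {n} (i : Fin n) (e : Monomial n) → mdeg (bump i e) ≡ suc (mdeg e)
  mdeg-bump zero    e = refl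
  mdeg-bump (suc i) e = trans (cong (e zero ℕ.+_) (mdeg-bump i (λ k → e (suc k)))) (+-suc (e zero) _)

  evalMon-bump : ∀ {n} (i : Fin n) (e : Monomial n) y → evalMon (bump i e) y ≈ y i ⊗ evalMon e y
  evalMon-bump zero    e y = *-assoc _ _ _
  evalMon-bump (suc i) e y = ≈-trans (*-congˡ (evalMon-bump i (λ k → e (suc k)) (λ k → y (suc k))))
                                     (x∙yz≈y∙xz _ _ _)

  constant : ∀ {n} → Carrier → Polynomial n
  constant a = (a , λ _ → 0) ∷ []

  eval-constant : ∀ {n} a (y : Fin n → Carrier) → eval (constant a) y ≈ a
  eval-constant {n} a y = begin
    a ⊗ prodFin {n} (λ _ → 1#) ⊕ 0# ≈⟨ +-identityʳ _ ⟩
    a ⊗ prodFin {n} (λ _ → 1#)      ≈⟨ *-congˡ (prodFin-1 n) ⟩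
    a ⊗ 1#                          ≈⟨ *-identityʳ a ⟩
    a                               ∎
    where
    prodFin-1 : ∀ n → prodFin {n} (λ _ → 1#) ≈ 1#
    prodFin-1 zero    = ≈-refl
    prodFin-1 (suc n) = ≈-trans (*-identityˡ _) (prodFin-1 n)

  degree-constant : ∀ {n} d a → DegreeAtMost {n} d (constant a)
  degree-constant {n} d a = subst (_≤ d) (sym (mdeg-0 n)) z≤n ∷ []
    where
    mdeg-0 : ∀ n → mdeg {n} (λ _ → 0) ≡ 0
    mdeg-0 zero    = refl
    mdeg-0 (suc n) = mdeg-0 n

  eval-++ : ∀ {n} (P Q : Polynomial n) y → eval (P ++ Q) y ≈ eval P y ⊕ eval Q y
  eval-++ []            Q y = ≈-sym (+-identityˡ _)
  eval-++ ((a , e) ∷ P) Q y = ≈-trans (+-congˡ (eval-++ P Q y)) (≈-sym (+-assoc _ _ _))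

  negate : ∀ {n} → Polynomial n → Polynomial n
  negate = map (λ (a , e) → (- a , e))

  eval-negate : ∀ {n} (P : Polynomial n) y → eval (negate P) y ≈ - eval P y
  eval-negate []            y = ≈-sym -0#≈0#
  eval-negate ((a , e) ∷ P) y = begin
    - a ⊗ evalMon e y ⊕ eval (negate P) y ≈⟨ +-cong (≈-sym (-‿distribˡ-* a _)) (eval-negate P y) ⟩
    - (a ⊗ evalMon e y) ⊕ - eval P y      ≈⟨ -‿+-comm _ _ ⟩
    - (a ⊗ evalMon e y ⊕ eval P y)        ∎

  degree-negate : ∀ {n} d (P : Polynomial n) → DegreeAtMost d P → DegreeAtMost d (negate P)
  degree-negate d []      []       = []
  degree-negate d (_ ∷ P) (p ∷ ps) = p ∷ degree-negate d P ps

  mulVar : ∀ {n} → Fin n → Polynomial n → Polynomial n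
  mulVar i = map (λ (a , e) → (a , bump i e))

  eval-mulVar : ∀ {n} i (P : Polynomial n) y → eval (mulVar i P) y ≈ y i ⊗ eval P y
  eval-mulVar i []            y = ≈-sym (zeroʳ _)
  eval-mulVar i ((a , e) ∷ P) y = begin
    a ⊗ evalMon (bump i e) y ⊕ eval (mulVar i P) y
      ≈⟨ +-cong (*-congˡ (evalMon-bump i e y)) (eval-mulVar i P y) ⟩
    a ⊗ (y i ⊗ evalMon e y) ⊕ y i ⊗ eval P y ≈⟨ +-congʳ (x∙yz≈y∙xz _ _ _) ⟩
    y i ⊗ (a ⊗ evalMon e y) ⊕ y i ⊗ eval P y ≈⟨ ≈-sym (distribˡ _ _ _) ⟩
    y i ⊗ (a ⊗ evalMon e y ⊕ eval P y)       ∎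

  degree-mulVar : ∀ {n} d i (P : Polynomial n) → DegreeAtMost d P → DegreeAtMost (suc d) (mulVar i P)
  degree-mulVar d i []            []       = []
  degree-mulVar d i ((a , e) ∷ P) (p ∷ ps) =
    subst (_≤ suc d) (sym (mdeg-bump i e)) (s≤s p) ∷ degree-mulVar d i P ps

  degree-suc : ∀ {n} d (P : Polynomial n) → DegreeAtMost d P → DegreeAtMost (suc d) P
  degree-suc d P = All.map m≤n⇒m≤1+n

  -- The literal ℓ_b(t) = t if b is true and 1 - t if b is false; on {0,1}
  -- it is the indicator of the value b.
  literal : Bool → Carrier → Carrier
  literal true  t = t
  literal false t = 1# ⊕ - t

  literal-same : ∀ b → literal b ⌜ b ⌝ ≈ 1#
  literal-same true  = ≈-refl
  literal-same false = ≈-trans (+-congˡ -0#≈0#) (+-identityʳ 1#)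

  literal-other : ∀ b c → c ≢ b → literal b ⌜ c ⌝ ≈ 0#
  literal-other true  true  c≢b = ⊥-elim (c≢b refl)
  literal-other true  false _   = ≈-refl
  literal-other false true  _   = -‿inverseʳ 1#
  literal-other false false c≢b = ⊥-elim (c≢b refl)

  mulLiteral : ∀ {n} → Bool → Fin n → Polynomial n → Polynomial n
  mulLiteral true  i P = mulVar i P
  mulLiteral false i P = P ++ negate (mulVar i P)

  eval-mulLiteral : ∀ {n} b i (P : Polynomial n) y →
                    eval (mulLiteral b i P) y ≈ literal b (y i) ⊗ eval P y
  eval-mulLiteral true  i P y = eval-mulVar i P y
  eval-mulLiteral false i P y = begin
    eval (P ++ negate (mulVar i P)) y          ≈⟨ eval-++ P _ y ⟩
    eval P y ⊕ eval (negate (mulVar i P)) y    ≈⟨ +-congˡ (eval-negate (mulVar i P) y) ⟩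
    eval P y ⊕ - eval (mulVar i P) y           ≈⟨ +-congˡ (-‿cong (eval-mulVar i P y)) ⟩
    eval P y ⊕ - (y i ⊗ eval P y)              ≈⟨ +-cong (≈-sym (*-identityˡ _)) (-‿distribˡ-* _ _) ⟩
    1# ⊗ eval P y ⊕ (- y i) ⊗ eval P y         ≈⟨ ≈-sym (distribʳ _ _ _) ⟩
    (1# ⊕ - y i) ⊗ eval P y                    ∎

  degree-mulLiteral : ∀ {n} d b i (P : Polynomial n) →
                      DegreeAtMost d P → DegreeAtMost (suc d) (mulLiteral b i P)
  degree-mulLiteral d true  i P deg = degree-mulVar d i P deg
  degree-mulLiteral d false i P deg =
    All.++⁺ (degree-suc d P deg) (degree-negate (suc d) (mulVar i P) (degree-mulVar d i P deg))

larger-part-shorter : ∀ {s l n} → 0 < s → s ℕ.+ l ≡ n → l < n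
larger-part-shorter {s} {l} 0<s s+l≡n = subst (l <_) s+l≡n (m<n+m l 0<s)

smaller-part-half : ∀ {s l c} → s ≤ l → s ℕ.+ l < 2 ℕ.* c → s < c
smaller-part-half {s} {l} {c} s≤l s+l<2c with s <? c
... | yes s<c = s<c
... | no s≮c = ⊥-elim (<-irrefl refl (<-≤-trans s+l<2c 2c≤s+l))
  where
  c≤s : c ≤ s
  c≤s = ≮⇒≥ s≮c
  2c≤s+l : 2 ℕ.* c ≤ s ℕ.+ l
  2c≤s+l = ℕₚ.+-mono-≤ c≤s (subst (_≤ l) (sym (ℕₚ.+-identityʳ c)) (≤-trans c≤s s≤l))

∈⇒nonempty : ∀ {A : Set} {x : A} {ys} → x ∈ ys → 0 < length ys
∈⇒nonempty (here _)  = s≤s z≤n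
∈⇒nonempty (there _) = s≤s z≤n

-- Interpolation on a finite set of points x, observed through Boolean
-- coordinates v x i, by polynomials in the variables Y_i ↦ ⌜ v x i ⌝.
module Interpolation {c ℓ} (F : Field c ℓ) {X : Set} {n : ℕ} (v : X → Fin n → Bool) where
  open Field F hiding (zero) renaming (_+_ to _⊕_; _*_ to _⊗_; refl to ≈-refl; sym to ≈-sym; trans to ≈-trans)
  open Poly F
  open PolynomialAlgebra F
  open import Algebra.Properties.AbelianGroup +-abelianGroup using (xyx⁻¹≈y)
  open import Relation.Binary.Reasoning.Setoid setoid

  profile : X → Fin n → Carrier
  profile x i = ⌜ v x i ⌝

  Distinguished : X → X → Set
  Distinguished x y = Σ (Fin n) λ i → v x i ≢ v y i

  Separated : List X → Set
  Separated = AllPairs Distinguished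

  Interpolates : (X → Carrier) → Polynomial n → List X → Set ℓ
  Interpolates g P xs = ∀ x → x ∈ xs → g x ≈ eval P (profile x)

  Interpolant : ℕ → (X → Carrier) → List X → Set (c ⊔ ℓ)
  Interpolant d g xs = Σ (Polynomial n) λ P → DegreeAtMost d P × Interpolates g P xs

  side : Bool → Fin n → List X → List X
  side b i = filter (λ x → v x i ≟ᵇ b)

  side-sizes : ∀ b i xs → length (side b i xs) ℕ.+ length (side (not b) i xs) ≡ length xs
  side-sizes b i []       = refl
  side-sizes b i (x ∷ xs) with v x i | b
  ... | true  | true  = cong suc (side-sizes true i xs)
  ... | false | false = cong suc (side-sizes false i xs)
  ... | true  | false = trans (+-suc _ _) (cong suc (side-sizes false i xs))
  ... | false | true  = trans (+-suc _ _) (cong suc (side-sizes true i xs))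

  side-inhabited : ∀ {x₀ x₁ xs} i → x₀ ∈ xs → x₁ ∈ xs → v x₀ i ≢ v x₁ i → ∀ b → 0 < length (side b i xs)
  side-inhabited {x₀} {x₁} i x₀∈ x₁∈ x₀≢x₁ b with v x₀ i ≟ᵇ b
  ... | yes x₀ᵢ≡b = ∈⇒nonempty (∈-filter⁺ (λ x → v x i ≟ᵇ b) x₀∈ x₀ᵢ≡b)
  ... | no x₀ᵢ≢b = ∈⇒nonempty (∈-filter⁺ (λ x → v x i ≟ᵇ b) x₁∈
                     (trans (¬-not (x₀≢x₁ ∘ sym)) (sym (¬-not (x₀ᵢ≢b ∘ sym)))))

  record BalancedSplit (i : Fin n) (xs : List X) : Set where
    field
      bit      : Bool
      nonempty : 0 < length (side bit i xs)
      smaller  : length (side bit i xs) ≤ length (side (not bit) i xs)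

  balanced-side : ∀ {x₀ x₁ xs} i → x₀ ∈ xs → x₁ ∈ xs → v x₀ i ≢ v x₁ i → BalancedSplit i xs
  balanced-side {xs = xs} i x₀∈ x₁∈ x₀≢x₁ with length (side true i xs) ≤? length (side false i xs)
  ... | yes T≤F = record { bit = true  ; nonempty = side-inhabited i x₀∈ x₁∈ x₀≢x₁ true  ; smaller = T≤F }
  ... | no T≰F  = record { bit = false ; nonempty = side-inhabited i x₀∈ x₁∈ x₀≢x₁ false ; smaller = <⇒≤ (≰⇒> T≰F) }

  eval-glue : ∀ b i (Q R : Polynomial n) y →
              eval (Q ++ mulLiteral b i R) y ≈ eval Q y ⊕ literal b (y i) ⊗ eval R y
  eval-glue b i Q R y = ≈-trans (eval-++ Q _ y) (+-congˡ (eval-mulLiteral b i R y))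

  residual : (X → Carrier) → Polynomial n → X → Carrier
  residual g Q x = g x ⊕ - eval Q (profile x)

  glue : ∀ b i g xs (Q R : Polynomial n) →
         Interpolates g Q (side (not b) i xs) →
         Interpolates (residual g Q) R (side b i xs) →
         Interpolates g (Q ++ mulLiteral b i R) xs
  glue b i g xs Q R onL onS x x∈xs with v x i ≟ᵇ b
  ... | yes xᵢ≡b = ≈-sym (begin
    eval (Q ++ mulLiteral b i R) (profile x)     ≈⟨ eval-glue b i Q R (profile x) ⟩
    q ⊕ literal b ⌜ v x i ⌝ ⊗ eval R (profile x) ≈⟨ +-congˡ (*-congʳ (reflexive (cong (literal b ∘ ⌜_⌝) xᵢ≡b))) ⟩
    q ⊕ literal b ⌜ b ⌝ ⊗ eval R (profile x)     ≈⟨ +-congˡ (*-cong (literal-same b) (≈-sym (onS x x∈S))) ⟩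
    q ⊕ 1# ⊗ (g x ⊕ - q)                          ≈⟨ +-congˡ (*-identityˡ _) ⟩
    q ⊕ (g x ⊕ - q)                               ≈⟨ ≈-sym (+-assoc q (g x) (- q)) ⟩
    q ⊕ g x ⊕ - q                                 ≈⟨ xyx⁻¹≈y q (g x) ⟩
    g x                                           ∎)
    where
    q = eval Q (profile x)
    x∈S = ∈-filter⁺ (λ x → v x i ≟ᵇ b) x∈xs xᵢ≡b
  ... | no xᵢ≢b = ≈-sym (begin
    eval (Q ++ mulLiteral b i R) (profile x)     ≈⟨ eval-glue b i Q R (profile x) ⟩
    q ⊕ literal b ⌜ v x i ⌝ ⊗ eval R (profile x) ≈⟨ +-congˡ (*-congʳ (literal-other b (v x i) xᵢ≢b)) ⟩
    q ⊕ 0# ⊗ eval R (profile x)                  ≈⟨ +-congˡ (zeroˡ _) ⟩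
    q ⊕ 0#                                        ≈⟨ +-identityʳ q ⟩
    q                                             ≈⟨ ≈-sym (onL x x∈L) ⟩
    g x                                           ∎)
    where
    q = eval Q (profile x)
    x∈L = ∈-filter⁺ (λ x → v x i ≟ᵇ not b) x∈xs (¬-not xᵢ≢b)

  extend : ∀ {d} b i g xs → Interpolant (suc d) g (side (not b) i xs) →
           (∀ Q → Interpolant d (residual g Q) (side b i xs)) → Interpolant (suc d) g xs
  extend {d} b i g xs (Q , degQ , onL) interpolate-residual with interpolate-residual Q
  ... | R , degR , onS = Q ++ mulLiteral b i R , All.++⁺ degQ (degree-mulLiteral d b i R degR) ,
                         glue b i g xs Q R onL onS

  -- Main interpolation theorem: a separated list of fewer than 2^(d+1)
  -- points admits interpolation of any g in degree ≤ d.  The recursion is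
  -- on d and, for fixed d, on the length bound N.
  interpolate : ∀ d N xs → length xs ≤ N → length xs < 2 ^ suc d → Separated xs →
                ∀ g → Interpolant d g xs
  interpolate d N [] _ _ _ _ = [] , [] , λ _ ()
  interpolate d N (x ∷ []) _ _ _ g =
    constant (g x) , degree-constant d (g x) , λ { _ (here refl) → ≈-sym (eval-constant (g x) (profile x)) }
  interpolate zero    N       (_ ∷ _ ∷ _) _  (s≤s (s≤s ())) _ _
  interpolate (suc d) zero    (_ ∷ _ ∷ _) () _ _ _
  interpolate (suc d) (suc N) xs@(x₀ ∷ x₁ ∷ _) |xs|≤1+N |xs|<2^ sep@(((i , x₀≢x₁) ∷ _) ∷ _) g
    = extend b i g xs
      (interpolate (suc d) N L (ℕ.s≤s⁻¹ (<-≤-trans |L|<|xs| |xs|≤1+N)) (<-trans |L|<|xs| |xs|<2^)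
                   (AllPairs.filter⁺ (λ x → v x i ≟ᵇ not b) sep) g)
      (λ Q → interpolate d (length S) S ≤-refl |S|<2^ (AllPairs.filter⁺ (λ x → v x i ≟ᵇ b) sep) (residual g Q))
    where
    open BalancedSplit (balanced-side i (here refl) (there (here refl)) x₀≢x₁) renaming (bit to b)
    S L : List X
    S = side b i xs
    L = side (not b) i xs
    |L|<|xs| : length L < length xs
    |L|<|xs| = larger-part-shorter nonempty (side-sizes b i xs)
    |S|<2^ : length S < 2 ^ suc d
    |S|<2^ = smaller-part-half smaller (subst (_< 2 ^ suc (suc d)) (sym (side-sizes b i xs)) |xs|<2^)

distinguished : ∀ {m} (u : Fin m → Bool) → Aperiodic u →
                ∀ {x y} → x ≢ y → Σ (Fin m) λ j → shifted u j x ≢ shifted u j y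
distinguished {m} u aperiodic {x} {y} x≢y =
  ¬∀⟶∃¬ m (λ j → shifted u j x ≡ shifted u j y) (λ j → shifted u j x ≟ᵇ shifted u j y)
        (x≢y ∘ profile-injective u aperiodic x y)

lemma4p3 : ∀ {c ℓ} (F : Field c ℓ) (m : ℕ) (u : Fin m → Bool) → Aperiodic u →
           (g : Fin m → Field.Carrier F) →
           Σ (Poly.Polynomial F m) λ P →
             Poly.DegreeAtMost F ⌊log₂ m ⌋ P ×
             (∀ x → Field._≈_ F (g x) (Poly.eval F P (λ j → Poly.⌜_⌝ F (shifted u j x))))
lemma4p3 F m u aperiodic g with interpolate ⌊log₂ m ⌋ m (allFin m) (≤-reflexive |allFin|) |allFin|<2^ separated g
  where
  open Interpolation F (λ x j → shifted u j x)
  |allFin| : length (allFin m) ≡ m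
  |allFin| = length-tabulate (λ x → x)
  |allFin|<2^ : length (allFin m) < 2 ^ suc ⌊log₂ m ⌋
  |allFin|<2^ = subst (_< 2 ^ suc ⌊log₂ m ⌋) (sym |allFin|) (<2^[1+⌊log₂⌋] m)
  separated : Separated (allFin m)
  separated = AllPairs.map (distinguished u aperiodic) (allFin⁺ m)
... | P , degP , onAll = P , degP , λ x → onAll x (∈-allFin x)
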